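{- Let $n\ge1$. For every $\beta\in B_n$, $$\mathrm{fmaj}(\beta)=2\,\mathrm{maj}_R(\beta)-\mathrm{neg}(\beta).$$
   Context: $B_n$ is the group of bijections $\beta$ of $[-n,n]\setminus\{0\}$ with $\beta(-i)=-\beta(i)$, written in window notation $\beta=[\beta(1),\dots,\beta(n)]$. $\mathrm{neg}(\beta)=|\{i\in[n]:\beta(i)<0\}|$. $\mathrm{Des}_B(\beta)=\{i\in[0,n-1]:\beta(i)>\beta(i+1)\}$ using the natural order on integers and $\beta(0):=0$; $\mathrm{maj}(\beta)=\sum_{i\in\mathrm{Des}_B(\beta)}i$. The flag major index is $\mathrm{fmaj}(\beta)=2\,\mathrm{maj}(\beta)+\mathrm{neg}(\beta)$. Using the total order $1<_R\dots<_Rn<_R-n<_R\dots<_R-1$ on $[-n,n]\setminus\{0\}$, $\mathrm{Des}_R(\beta)=\{i\in[1,n]:\beta(i)>_R\beta(i+1)\}$ with $\beta(n+1):=n$, and $\mathrm{maj}_R(\beta)=\sum_{i\in\mathrm{Des}_R(\beta)}i$. -}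

module Defs where

open import Data.Nat using (ℕ; zero; suc; _+_; _*_; _<ᵇ_)
open import Data.Integer as ℤ using (ℤ; +_; -[1+_])
open import Data.Bool using (Bool; true; false; if_then_else_)
open import Data.Fin using (Fin; toℕ)
open import Data.Fin.Permutation using (Permutation′; _⟨$⟩ʳ_)
open import Data.List using (List; []; _∷_; _++_; map; allFin; sum; length; filter)
open import Relation.Nullary.Decidable using (does)

-- The hyperoctahedral group B_n, encoded by an underlying permutation σ of Fin n
-- and a sign vector: β(i+1) = ± (σ(i)+1), negative iff (negative i) = true.
-- This is in bijection with the signed permutations of [-n,n]∖{0}; β is
-- determined by its window [β(1),…,β(n)].
record B (n : ℕ) : Set where
  constructor signedPerm
  field
    perm     : Permutation′ n
    negative : Fin n → Bool

open B public

signed : Bool → ℕ → ℤ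
signed false k = + k
signed true  k = ℤ.- (+ k)

-- window notation [β(1), …, β(n)] (list position j holds β(j+1))
window : {n : ℕ} → B n → List ℤ
window {n} β = map (λ i → signed (negative β i) (suc (toℕ (perm β ⟨$⟩ʳ i)))) (allFin n)

neg : {n : ℕ} → B n → ℕ
neg β = length (filter (λ x → x ℤ.<? + 0) (window β))

descentSum : (ℤ → ℤ → Bool) → ℕ → List ℤ → ℕ
descentSum gt k []           = 0
descentSum gt k (x ∷ [])     = 0
descentSum gt k (x ∷ y ∷ xs) =
  (if gt x y then k else 0) + descentSum gt (suc k) (y ∷ xs)

gtℤ : ℤ → ℤ → Bool
gtℤ x y = does (y ℤ.<? x)

-- maj(β) = Σ_{i ∈ Des_B(β)} i,  Des_B over i ∈ [0,n-1] with β(0) := 0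
maj : {n : ℕ} → B n → ℕ
maj β = descentSum gtℤ 0 (+ 0 ∷ window β)

fmaj : {n : ℕ} → B n → ℕ
fmaj β = 2 * maj β + neg β

-- the total order 1 <_R … <_R n <_R -n <_R … <_R -1, via a rank in ℕ:
-- positive k ↦ k, negative -k ↦ 2n+1-k
rankR : ℕ → ℤ → ℕ
rankR n (+ k)      = k
rankR n -[1+ k ]   = 2 * n + 1 Data.Nat.∸ suc k

gtR : ℕ → ℤ → ℤ → Bool
gtR n x y = rankR n y <ᵇ rankR n x

-- maj_R(β) = Σ_{i ∈ Des_R(β)} i,  Des_R over i ∈ [1,n] with β(n+1) := n
majR : {n : ℕ} → B n → ℕ
majR {n} β = descentSum (gtR n) 1 (window β ++ (+ n ∷ []))

module Submission where

-- Write w = [β(1),…,β(n)] for the window of β.  Both maj(β)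
-- and maj_R(β) are weighted descent counts along w (maj reads 0 in front of
-- w, maj_R reads n behind it), so it suffices to show maj_R = maj + neg;
-- then fmaj = 2 maj + neg = 2 maj_R − neg.
-- The two orders differ only across a sign change: for entries x, y of a
-- window, [x >_R y] + [y < 0] = [x > y] + [x < 0], and [x >_R n] = [x < 0].

open import Defs
open import Data.Nat using (ℕ; _≤_; _*_)
open import Data.Integer as ℤ using (ℤ; +_; _-_)
open import Relation.Binary.PropositionalEquality using (_≡_)

open import Data.Nat as ℕ using (suc; _+_; _∸_; _<_; s≤s)
open import Data.Nat.Properties
open import Data.Nat.Tactic.RingSolver using (solve-∀)
import Data.Integer.Properties as ℤP
open import Data.Bool using (Bool; true; false; if_then_else_)
open import Data.Fin.Properties using (toℕ<n)
open import Data.Fin.Permutation using (_⟨$⟩ʳ_)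
open import Data.List using (List; []; _∷_; _++_; [_]; map; filter; length; allFin)
open import Data.Nat.ListAction using (sum)
open import Data.List.Relation.Unary.All using (All; []; _∷_; universal)
open import Data.List.Relation.Unary.All.Properties using (map⁺)
open import Function using (_⇔_; mk⇔)
open import Relation.Nullary using (does)
open import Relation.Nullary.Decidable using (dec-true; dec-false; does-⇔)
open import Relation.Unary using (Pred; Decidable)
open import Relation.Binary.PropositionalEquality using (refl; sym; trans; cong; cong₂; module ≡-Reasoning)

𝟙 : Bool → ℕ
𝟙 true  = 1
𝟙 false = 0

if-weight : ∀ (b : Bool) k → (if b then k else 0) ≡ k * 𝟙 b
if-weight true  k = sym (*-identityʳ k)
if-weight false k = sym (*-zeroʳ k)

length-filter≡sum : ∀ {a p} {A : Set a} {P : Pred A p} (P? : Decidable P) (xs : List A) →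
  length (filter P? xs) ≡ sum (map (λ x → 𝟙 (does (P? x))) xs)
length-filter≡sum P? [] = refl
length-filter≡sum P? (x ∷ xs) with does (P? x)
... | true  = cong suc (length-filter≡sum P? xs)
... | false = length-filter≡sum P? xs

-- A descent at position 0 has weight 0, so a leading entry read at
-- position 0 never contributes.
descentSum-position0 : ∀ gt x xs → descentSum gt 0 (x ∷ xs) ≡ descentSum gt 1 xs
descentSum-position0 gt x []       = refl
descentSum-position0 gt x (y ∷ ys) with gt x y
... | true  = refl
... | false = refl

module Telescope
  {p} {P : Pred ℤ p} (gt gt′ : ℤ → ℤ → Bool) (s : ℤ → ℕ) (z : ℤ)
  (exchange : ∀ {x y} → P x → P y → 𝟙 (gt x y) + s y ≡ 𝟙 (gt′ x y) + s x)
  (terminal : ∀ {x} → P x → 𝟙 (gt x z) ≡ s x)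
  where

  private
    regroup : ∀ k g g′ sx sy D S → g + sy ≡ g′ + sx →
      k * g + (D + suc k * sy + S) ≡ k * g′ + D + k * sx + (sy + S)
    regroup k g g′ sx sy D S eq = begin
      k * g + (D + suc k * sy + S)   ≡⟨ expand k g sy D S ⟩
      k * (g + sy) + (D + sy + S)    ≡⟨ cong (λ t → k * t + (D + sy + S)) eq ⟩
      k * (g′ + sx) + (D + sy + S)   ≡⟨ collect k g′ sx sy D S ⟩
      k * g′ + D + k * sx + (sy + S) ∎
      where
      open ≡-Reasoning
      expand : ∀ k g sy D S → k * g + (D + suc k * sy + S) ≡ k * (g + sy) + (D + sy + S)
      expand = solve-∀
      collect : ∀ k g′ sx sy D S → k * (g′ + sx) + (D + sy + S) ≡ k * g′ + D + k * sx + (sy + S)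
      collect = solve-∀

  telescope : ∀ k x xs → P x → All P xs →
    descentSum gt k (x ∷ xs ++ [ z ]) ≡ descentSum gt′ k (x ∷ xs) + k * s x + sum (map s xs)
  telescope k x [] px [] = begin
    (if gt x z then k else 0) + 0   ≡⟨ +-identityʳ _ ⟩
    (if gt x z then k else 0)       ≡⟨ if-weight (gt x z) k ⟩
    k * 𝟙 (gt x z)                  ≡⟨ cong (k *_) (terminal px) ⟩
    k * s x                         ≡⟨ sym (+-identityʳ _) ⟩
    k * s x + 0                     ∎
    where open ≡-Reasoning
  telescope k x (y ∷ ys) px (py ∷ pys) = begin
    (if gt x y then k else 0) + descentSum gt (suc k) (y ∷ ys ++ [ z ])
      ≡⟨ cong₂ _+_ (if-weight (gt x y) k) (telescope (suc k) y ys py pys) ⟩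
    k * 𝟙 (gt x y) + (D + suc k * s y + sum (map s ys))
      ≡⟨ regroup k _ _ _ _ D _ (exchange px py) ⟩
    k * 𝟙 (gt′ x y) + D + k * s x + (s y + sum (map s ys))
      ≡⟨ cong (λ t → t + D + k * s x + _) (sym (if-weight (gt′ x y) k)) ⟩
    (if gt′ x y then k else 0) + D + k * s x + sum (map s (y ∷ ys)) ∎
    where
    open ≡-Reasoning
    D : ℕ
    D = descentSum gt′ (suc k) (y ∷ ys)

data WindowEntry (n : ℕ) : ℤ → Set where
  entry : ∀ b a → a < n → WindowEntry n (signed b (suc a))

window-entries : ∀ {n} (β : B n) → All (WindowEntry n) (window β)
window-entries {n} β =
  map⁺ (universal (λ i → entry (negative β i) _ (toℕ<n (perm β ⟨$⟩ʳ i))) (allFin n))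

isNeg : ℤ → ℕ
isNeg x = 𝟙 (does (x ℤ.<? + 0))

neg≡sum-isNeg : ∀ {n} (β : B n) → neg β ≡ sum (map isNeg (window β))
neg≡sum-isNeg β = length-filter≡sum (λ x → x ℤ.<? + 0) (window β)

negative-rank-above : ∀ n a → a < n → n < 2 * n + 1 ∸ suc a
negative-rank-above n a a<n = m+n≤o⇒m≤o∸n (suc n) (begin
  suc n + suc a   ≤⟨ +-monoʳ-≤ (suc n) a<n ⟩
  suc n + n       ≡⟨ size n ⟩
  2 * n + 1       ∎)
  where
  open ≤-Reasoning
  size : ∀ n → suc n + n ≡ 2 * n + 1
  size = solve-∀

negative-rank-antitone : ∀ n a d → d < n →
  (2 * n + 1 ∸ suc d < 2 * n + 1 ∸ suc a) ⇔ a < d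
negative-rank-antitone n a d d<n = mk⇔ forward backward
  where
  forward : 2 * n + 1 ∸ suc d < 2 * n + 1 ∸ suc a → a < d
  forward lt = ≰⇒> (λ d≤a → <⇒≱ lt (∸-monoʳ-≤ (2 * n + 1) (s≤s d≤a)))
  backward : a < d → 2 * n + 1 ∸ suc d < 2 * n + 1 ∸ suc a
  backward a<d = ∸-monoʳ-< (s≤s a<d) 1+d≤2n+1
    where
    1+d≤2n+1 : suc d ≤ 2 * n + 1
    1+d≤2n+1 = ≤-trans d<n (≤-trans (m≤m+n n (n + 0)) (m≤m+n (2 * n) 1))

-- The local exchange law between <_R and the natural order: the two
-- descent tests disagree exactly across a sign change.
exchange : ∀ {n x y} → WindowEntry n x → WindowEntry n y →
  𝟙 (gtR n x y) + isNeg y ≡ 𝟙 (gtℤ x y) + isNeg x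
exchange (entry false a a<n) (entry false d d<n) = refl
exchange {n} (entry false a a<n) (entry true d d<n)
  rewrite dec-false (2 * n + 1 ∸ suc d ℕ.<? suc a)
            (≤⇒≯ (≤-trans a<n (<⇒≤ (negative-rank-above n d d<n)))) = refl
exchange {n} (entry true a a<n) (entry false d d<n)
  rewrite dec-true (suc d ℕ.<? 2 * n + 1 ∸ suc a)
            (≤-<-trans d<n (negative-rank-above n a a<n)) = refl
exchange {n} (entry true a a<n) (entry true d d<n)
  rewrite does-⇔ (negative-rank-antitone n a d d<n)
            (2 * n + 1 ∸ suc d ℕ.<? 2 * n + 1 ∸ suc a) (a ℕ.<? d) = refl

terminal : ∀ {n x} → WindowEntry n x → 𝟙 (gtR n x (+ n)) ≡ isNeg x
terminal {n} (entry false a a<n) rewrite dec-false (n ℕ.<? suc a) (≤⇒≯ a<n) = refl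
terminal {n} (entry true a a<n)
  rewrite dec-true (n ℕ.<? 2 * n + 1 ∸ suc a) (negative-rank-above n a a<n) = refl

majR-list : ∀ n (w : List ℤ) → All (WindowEntry n) w →
  descentSum (gtR n) 1 (w ++ [ + n ]) ≡ descentSum gtℤ 0 (+ 0 ∷ w) + sum (map isNeg w)
majR-list n [] [] = refl
majR-list n (x ∷ xs) (px ∷ pxs) = begin
  descentSum (gtR n) 1 (x ∷ xs ++ [ + n ])
    ≡⟨ telescope 1 x xs px pxs ⟩
  D + 1 * isNeg x + sum (map isNeg xs)
    ≡⟨ shift D (isNeg x) _ ⟩
  D + sum (map isNeg (x ∷ xs))
    ≡⟨ cong (_+ sum (map isNeg (x ∷ xs))) (sym (descentSum-position0 gtℤ (+ 0) (x ∷ xs))) ⟩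
  descentSum gtℤ 0 (+ 0 ∷ x ∷ xs) + sum (map isNeg (x ∷ xs)) ∎
  where
  open ≡-Reasoning
  open Telescope (gtR n) gtℤ isNeg (+ n) (λ {x} {y} → exchange {n} {x} {y}) (λ {x} → terminal {n} {x})
  D : ℕ
  D = descentSum gtℤ 1 (x ∷ xs)
  shift : ∀ D s S → D + 1 * s + S ≡ D + (s + S)
  shift = solve-∀

majR≡maj+neg : ∀ {n} (β : B n) → majR β ≡ maj β + neg β
majR≡maj+neg {n} β = trans (majR-list n (window β) (window-entries β))
  (cong (λ k → maj β + k) (sym (neg≡sum-isNeg β)))

+[m+n]-n≡m : ∀ m n → + (m + n) - + n ≡ + m
+[m+n]-n≡m m n = begin
  + (m + n) - + n          ≡⟨ cong (_- + n) (ℤP.pos-+ m n) ⟩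
  + m ℤ.+ + n - + n        ≡⟨ ℤP.+-assoc (+ m) (+ n) (ℤ.- + n) ⟩
  + m ℤ.+ (+ n - + n)      ≡⟨ cong (λ i → + m ℤ.+ i) (ℤP.+-inverseʳ (+ n)) ⟩
  + m ℤ.+ + 0              ≡⟨ ℤP.+-identityʳ (+ m) ⟩
  + m                      ∎
  where open ≡-Reasoning

corollary3p3 : (n : ℕ) → 1 ≤ n → (β : B n) →
    + fmaj β ≡ + (2 * majR β) - + neg β
corollary3p3 n _ β = begin
  + (2 * maj β + neg β)                     ≡⟨ sym (+[m+n]-n≡m _ (neg β)) ⟩
  + (2 * maj β + neg β + neg β) - + neg β   ≡⟨ cong (λ k → + k - + neg β) (double (maj β) (neg β)) ⟩
  + (2 * (maj β + neg β)) - + neg β         ≡⟨ cong (λ k → + (2 * k) - + neg β) (sym (majR≡maj+neg β)) ⟩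
  + (2 * majR β) - + neg β                  ∎
  where
  open ≡-Reasoning
  double : ∀ m g → 2 * m + g + g ≡ 2 * (m + g)
  double = solve-∀
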